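{- Let $r > 0$. Consider a bipartite graph with sides $X, Y$ such that the number of edges $e(X,Y)$ satisfies $e(X,Y) \leq r|Y|$. Then there are $X' \subseteq X$ and $Y' \subseteq Y$ with $|X'| \geq \lfloor |X|/(r+1) \rfloor$ and $|Y'| \geq \lfloor |Y|/(r+1) \rfloor$ such that there are no edges between $X'$ and $Y'$.
   Formalization: The parameter r ranges over the positive rationals. -}

module Defs where

open import Data.Bool using (Bool; true; false; if_then_else_)
open import Data.Nat using (ℕ)
open import Data.Fin using (Fin)
open import Data.List using (map; allFin)
open import Data.Nat.ListAction using (sum)
open import Data.Integer using (ℤ; +_)
open import Data.Rational using (ℚ; 0ℚ; 1ℚ; _<_; _+_; _÷_; _/_; floor; positive; Positive)
open import Data.Rational.Properties using (pos+nonNeg⇒pos; pos⇒nonZero)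

BipGraph : ℕ → ℕ → Set
BipGraph m n = Fin m → Fin n → Bool

edgeCount : ∀ {m n} → BipGraph m n → ℕ
edgeCount {m} {n} E =
  sum (map (λ x → sum (map (λ y → if E x y then 1 else 0) (allFin n))) (allFin m))

toℚ : ℕ → ℚ
toℚ a = (+ a) / 1

floorDivSucc : ℕ → (r : ℚ) → 0ℚ < r → ℤ
floorDivSucc a r 0<r = floor (_÷_ (toℚ a) (r + 1ℚ) {{nz}})
  where
    instance
      posr : Positive r
      posr = positive 0<r
    nz = pos⇒nonZero (r + 1ℚ) {{pos+nonNeg⇒pos r 1ℚ}}

module Submission where

-- With m = |X|, n = |Y| and e = e(X,Y) ≤ r n, let X′ be the p = ⌊m/(r+1)⌋ vertices of X
-- of smallest degree and s the sum of their degrees.  Averaging gives m s ≤ p e, so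
-- s ≤ r n/(r+1).  Let Y′ be the vertices of Y with no neighbour in X′: at most s vertices
-- of Y are lost, so |Y′| ≥ n − r n/(r+1) = n/(r+1).

open import Defs
open import Data.Bool using (Bool; true; false; if_then_else_)
open import Data.Bool.Properties using (¬-not)
open import Data.Fin using (Fin; zero; suc)
open import Data.Fin.Subset using (Subset; _∈_; _∉_; ∣_∣; _∪_; ∁; ⋃; ⁅_⁆; inside; outside)
open import Data.Fin.Subset.Properties
  using (∣⊥∣≡0; ∣p∣≤∣x∷p∣; ∣∁p∣≡n∸∣p∣; ∣⁅x⁆∣≡1; x∈⁅x⁆; x∈p∪q⁺; x∈∁p⇒x∉p)
open import Data.List using (List; []; _∷_; _++_; map; allFin; take; drop; length)
import Data.List as List
open import Data.List.Membership.Propositional using () renaming (_∈_ to _∈ₗ_; _∉_ to _∉ₗ_)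
open import Data.List.Membership.Propositional.Properties using (∈-allFin; ∈-++⁻; ∈-map⁺)
open import Data.List.Properties
  using (map-∘; map-cong; map-tabulate; map-++; take++drop≡id; length-take; length-++; length-tabulate)
open import Data.List.Relation.Binary.Permutation.Propositional using (_↭_; ↭-sym)
open import Data.List.Relation.Binary.Permutation.Propositional.Properties
  using (∈-resp-↭; ↭-length; map⁺)
open import Data.List.Relation.Unary.All as All using ()
open import Data.List.Relation.Unary.All.Properties using (++⁻ʳ)
open import Data.List.Relation.Unary.AllPairs using (AllPairs; _∷_)
open import Data.List.Relation.Unary.Any using (here; there)
open import Data.List.Relation.Unary.Linked.Properties using (Linked⇒AllPairs)
open import Data.Nat as ℕ using (ℕ; zero; suc)
import Data.Nat.DivMod as ℕ
open import Data.Nat.ListAction using (sum)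
open import Data.Nat.ListAction.Properties using (sum-↭; sum-++)
import Data.Nat.Properties as ℕ
open import Data.Product using (Σ; _×_; _,_)
open import Data.Sum using (inj₁; inj₂)
open import Data.Vec using (_∷_; [])
import Data.Vec as Vec
open import Data.Vec.Properties using (lookup⇒[]=; lookup∘tabulate)
open import Function using (_∘_)
import Relation.Binary.Construct.On as On
open import Relation.Binary.PropositionalEquality
open import Relation.Nullary using (contradiction)

module Counting where

  open import Data.Nat using (_+_; _*_; _∸_; _≤_; _<_; z≤n; s≤s)
  open import Data.Nat.Properties
  open import Data.Nat.Solver using (module +-*-Solver)
  open +-*-Solver

  ∣p∪q∣≤∣p∣+∣q∣ : ∀ {n} (p q : Subset n) → ∣ p ∪ q ∣ ≤ ∣ p ∣ + ∣ q ∣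
  ∣p∪q∣≤∣p∣+∣q∣ []            []            = z≤n
  ∣p∪q∣≤∣p∣+∣q∣ (inside  ∷ p) (x       ∷ q) =
    s≤s (≤-trans (∣p∪q∣≤∣p∣+∣q∣ p q) (+-monoʳ-≤ ∣ p ∣ (∣p∣≤∣x∷p∣ x q)))
  ∣p∪q∣≤∣p∣+∣q∣ (outside ∷ p) (outside ∷ q) = ∣p∪q∣≤∣p∣+∣q∣ p q
  ∣p∪q∣≤∣p∣+∣q∣ (outside ∷ p) (inside  ∷ q) =
    ≤-trans (s≤s (∣p∪q∣≤∣p∣+∣q∣ p q)) (≤-reflexive (sym (+-suc ∣ p ∣ ∣ q ∣)))

  ∣⋃ps∣≤sum∣ps∣ : ∀ {n} (ps : List (Subset n)) → ∣ ⋃ ps ∣ ≤ sum (map ∣_∣ ps)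
  ∣⋃ps∣≤sum∣ps∣ {n} []       = ≤-reflexive (∣⊥∣≡0 n)
  ∣⋃ps∣≤sum∣ps∣     (p ∷ ps) = ≤-trans (∣p∪q∣≤∣p∣+∣q∣ p (⋃ ps)) (+-monoʳ-≤ ∣ p ∣ (∣⋃ps∣≤sum∣ps∣ ps))

  x∈p∈ps⇒x∈⋃ps : ∀ {n} {x : Fin n} {p ps} → p ∈ₗ ps → x ∈ p → x ∈ ⋃ ps
  x∈p∈ps⇒x∈⋃ps (here refl) x∈p = x∈p∪q⁺ (inj₁ x∈p)
  x∈p∈ps⇒x∈⋃ps (there p∈ps) x∈p = x∈p∪q⁺ (inj₂ (x∈p∈ps⇒x∈⋃ps p∈ps x∈p))

  x∈∁⋃ps⇒x∉p : ∀ {n} {x : Fin n} {p ps} → x ∈ ∁ (⋃ ps) → p ∈ₗ ps → x ∉ p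
  x∈∁⋃ps⇒x∉p x∈∁⋃ps p∈ps x∈p = x∈∁p⇒x∉p x∈∁⋃ps (x∈p∈ps⇒x∈⋃ps p∈ps x∈p)

  n≤sum∣ps∣+∣∁⋃ps∣ : ∀ {n} (ps : List (Subset n)) → n ≤ sum (map ∣_∣ ps) + ∣ ∁ (⋃ ps) ∣
  n≤sum∣ps∣+∣∁⋃ps∣ {n} ps = begin
    n                                 ≤⟨ m≤n+m∸n n ∣ ⋃ ps ∣ ⟩
    ∣ ⋃ ps ∣ + (n ∸ ∣ ⋃ ps ∣)          ≡⟨ cong (∣ ⋃ ps ∣ +_) (∣∁p∣≡n∸∣p∣ (⋃ ps)) ⟨
    ∣ ⋃ ps ∣ + ∣ ∁ (⋃ ps) ∣            ≤⟨ +-monoˡ-≤ ∣ ∁ (⋃ ps) ∣ (∣⋃ps∣≤sum∣ps∣ ps) ⟩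
    sum (map ∣_∣ ps) + ∣ ∁ (⋃ ps) ∣    ∎
    where open ≤-Reasoning

  AllPairs-++⇒across : ∀ {A : Set} {R : A → A → Set} xs ys → AllPairs R (xs ++ ys) →
    ∀ {x y} → x ∈ₗ xs → y ∈ₗ ys → R x y
  AllPairs-++⇒across (_ ∷ xs) ys (Rx ∷ _)  (here refl) y∈ys = All.lookup (++⁻ʳ xs Rx) y∈ys
  AllPairs-++⇒across (_ ∷ xs) ys (_ ∷ Rxs) (there x∈xs) y∈ys = AllPairs-++⇒across xs ys Rxs x∈xs y∈ys

  module _ {A : Set} (w : A → ℕ) where

    sum≤length* : ∀ {c} xs → (∀ {x} → x ∈ₗ xs → w x ≤ c) → sum (map w xs) ≤ length xs * c
    sum≤length* []       _     = z≤n
    sum≤length* (x ∷ xs) w≤c = +-mono-≤ (w≤c (here refl)) (sum≤length* xs (w≤c ∘ there))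

    length*sum≤length*sum : ∀ xs ys → (∀ {x y} → x ∈ₗ xs → y ∈ₗ ys → w x ≤ w y) →
      length ys * sum (map w xs) ≤ length xs * sum (map w ys)
    length*sum≤length*sum xs []       _     = z≤n
    length*sum≤length*sum xs (y ∷ ys) xs≤ys = begin
      sum (map w xs) + length ys * sum (map w xs)
        ≤⟨ +-mono-≤ (sum≤length* xs (λ x∈xs → xs≤ys x∈xs (here refl)))
                    (length*sum≤length*sum xs ys (λ x∈xs → xs≤ys x∈xs ∘ there)) ⟩
      length xs * w y + length xs * sum (map w ys) ≡⟨ *-distribˡ-+ (length xs) (w y) _ ⟨
      length xs * (w y + sum (map w ys))           ∎
      where open ≤-Reasoning

    sum-map-++ : ∀ xs ys → sum (map w (xs ++ ys)) ≡ sum (map w xs) + sum (map w ys)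
    sum-map-++ xs ys = trans (cong sum (map-++ w xs ys)) (sum-++ (map w xs) (map w ys))

    prefix-average : ∀ xs ys → (∀ {x y} → x ∈ₗ xs → y ∈ₗ ys → w x ≤ w y) →
      length (xs ++ ys) * sum (map w xs) ≤ length xs * sum (map w (xs ++ ys))
    prefix-average xs ys xs≤ys = begin
      length (xs ++ ys) * Sx                ≡⟨ cong (_* Sx) (length-++ xs) ⟩
      (length xs + length ys) * Sx          ≡⟨ *-distribʳ-+ Sx (length xs) (length ys) ⟩
      length xs * Sx + length ys * Sx       ≤⟨ +-monoʳ-≤ (length xs * Sx) (length*sum≤length*sum xs ys xs≤ys) ⟩
      length xs * Sx + length xs * Sy       ≡⟨ *-distribˡ-+ (length xs) Sx Sy ⟨
      length xs * (Sx + Sy)                 ≡⟨ cong (length xs *_) (sum-map-++ xs ys) ⟨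
      length xs * sum (map w (xs ++ ys))    ∎
      where
      open ≤-Reasoning
      Sx = sum (map w xs)
      Sy = sum (map w ys)

    average-split : ∀ xs {p} → p ≤ length xs →
      Σ (List A) λ ls → Σ (List A) λ hs →
        ls ++ hs ↭ xs × length ls ≡ p × length xs * sum (map w ls) ≤ p * sum (map w xs)
    average-split xs {p} p≤∣xs∣ = ls , hs , ls++hs↭xs , ∣ls∣≡p , (begin
      length xs * sum (map w ls)         ≡⟨ cong (_* sum (map w ls)) (↭-length ls++hs↭xs) ⟨
      length (ls ++ hs) * sum (map w ls) ≤⟨ prefix-average ls hs ls≤hs ⟩
      length ls * sum (map w (ls ++ hs)) ≡⟨ cong₂ _*_ ∣ls∣≡p (sum-↭ (map⁺ w ls++hs↭xs)) ⟩
      p * sum (map w xs)                 ∎)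
      where
      open ≤-Reasoning
      open import Data.List.Sort (On.decTotalOrder ≤-decTotalOrder w) using (sort; sort-↭; sort-↗)
      ls = take p (sort xs)
      hs = drop p (sort xs)
      ls++hs↭xs : ls ++ hs ↭ xs
      ls++hs↭xs = subst (_↭ xs) (sym (take++drop≡id p (sort xs))) (sort-↭ xs)
      ∣ls∣≡p : length ls ≡ p
      ∣ls∣≡p = trans (length-take p (sort xs))
                     (m≤n⇒m⊓n≡m (subst (p ≤_) (sym (↭-length (sort-↭ xs))) p≤∣xs∣))
      ls≤hs : ∀ {x y} → x ∈ₗ ls → y ∈ₗ hs → w x ≤ w y
      ls≤hs = AllPairs-++⇒across ls hs
        (subst (AllPairs _) (sym (take++drop≡id p (sort xs))) (Linked⇒AllPairs ≤-trans (sort-↗ xs)))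

  ∣tabulate∣ : ∀ {n} (f : Fin n → Bool) →
    ∣ Vec.tabulate f ∣ ≡ sum (List.tabulate (λ y → if f y then 1 else 0))
  ∣tabulate∣ {zero}  f = refl
  ∣tabulate∣ {suc n} f with f zero
  ... | true  = cong suc (∣tabulate∣ (f ∘ suc))
  ... | false = ∣tabulate∣ (f ∘ suc)

  ∈-tabulate⁺ : ∀ {n} {f : Fin n → Bool} {y} → f y ≡ true → y ∈ Vec.tabulate f
  ∈-tabulate⁺ {f = f} {y} fy≡true = lookup⇒[]= y (Vec.tabulate f) (trans (lookup∘tabulate f y) fy≡true)

  neighbours : ∀ {m n} → BipGraph m n → Fin m → Subset n
  neighbours E x = Vec.tabulate (E x)

  degree : ∀ {m n} → BipGraph m n → Fin m → ℕ
  degree E x = ∣ neighbours E x ∣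

  edgeCount≡sum-degree : ∀ {m n} (E : BipGraph m n) → edgeCount E ≡ sum (map (degree E) (allFin m))
  edgeCount≡sum-degree {n = n} E = cong sum (map-cong degree≡count (allFin _))
    where
    degree≡count : ∀ x → sum (map (λ y → if E x y then 1 else 0) (allFin n)) ≡ degree E x
    degree≡count x =
      trans (cong sum (map-tabulate (λ y → y) (λ y → if E x y then 1 else 0))) (sym (∣tabulate∣ (E x)))

  commonNonNeighbours : ∀ {m n} → BipGraph m n → List (Fin m) → Subset n
  commonNonNeighbours E xs = ∁ (⋃ (map (neighbours E) xs))

  n≤sum-degree+∣commonNonNeighbours∣ : ∀ {m n} (E : BipGraph m n) xs →
    n ≤ sum (map (degree E) xs) + ∣ commonNonNeighbours E xs ∣
  n≤sum-degree+∣commonNonNeighbours∣ {n = n} E xs =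
    subst (λ ds → n ≤ sum ds + ∣ commonNonNeighbours E xs ∣) (sym (map-∘ xs))
          (n≤sum∣ps∣+∣∁⋃ps∣ (map (neighbours E) xs))

  commonNonNeighbours-noEdge : ∀ {m n} (E : BipGraph m n) {xs x y} → x ∈ₗ xs →
    y ∈ commonNonNeighbours E xs → E x y ≡ false
  commonNonNeighbours-noEdge E x∈xs y∈Y′ =
    ¬-not (x∈∁⋃ps⇒x∉p y∈Y′ (∈-map⁺ (neighbours E) x∈xs) ∘ ∈-tabulate⁺)

  avoiding : ∀ {m} → List (Fin m) → Subset m
  avoiding xs = ∁ (⋃ (map ⁅_⁆ xs))

  m≤length+∣avoiding∣ : ∀ {m} (xs : List (Fin m)) → m ≤ length xs + ∣ avoiding xs ∣
  m≤length+∣avoiding∣ {m} xs =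
    subst (λ k → m ≤ k + ∣ avoiding xs ∣) (sum-ones xs) (n≤sum∣ps∣+∣∁⋃ps∣ (map ⁅_⁆ xs))
    where
    sum-ones : ∀ xs → sum (map ∣_∣ (map ⁅_⁆ xs)) ≡ length xs
    sum-ones []       = refl
    sum-ones (x ∷ xs) = cong₂ _+_ (∣⁅x⁆∣≡1 x) (sum-ones xs)

  avoiding-∉ : ∀ {m} {xs : List (Fin m)} {x} → x ∈ avoiding xs → x ∉ₗ xs
  avoiding-∉ x∈ x∈xs = x∈∁⋃ps⇒x∉p x∈ (∈-map⁺ ⁅_⁆ x∈xs) (x∈⁅x⁆ _)

  length-allFin : ∀ m → length (allFin m) ≡ m
  length-allFin m = length-tabulate (λ x → x)

  length≡0⇒sum-map≡0 : ∀ {A : Set} (w : A → ℕ) {xs} → length xs ≡ 0 → sum (map w xs) ≡ 0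
  length≡0⇒sum-map≡0 w {[]} _ = refl

  -- X′ is the complement of the heavy vertices hs rather than the set of light ones ls:
  -- the union bound then gives its size without knowing that ls has no repetitions.
  edgeless-pair : ∀ {m n} (E : BipGraph m n) {p} → p ≤ m →
    Σ (Subset m) λ X′ → Σ (Subset n) λ Y′ → Σ ℕ λ s →
      p ≤ ∣ X′ ∣ × n ≤ s + ∣ Y′ ∣ × m * s ≤ p * edgeCount E × (p ≡ 0 → s ≡ 0) ×
      (∀ x y → x ∈ X′ → y ∈ Y′ → E x y ≡ false)
  edgeless-pair {m} {n} E {p} p≤m
    with ls , hs , ls++hs↭ , ∣ls∣≡p , average
           ← average-split (degree E) (allFin m) (subst (p ≤_) (sym (length-allFin m)) p≤m)
    = avoiding hs , commonNonNeighbours E ls , sum (map (degree E) ls)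
    , p≤∣X′∣ , n≤sum-degree+∣commonNonNeighbours∣ E ls
    , subst₂ (λ k e → k * sum (map (degree E) ls) ≤ p * e)
             (length-allFin m) (sym (edgeCount≡sum-degree E)) average
    , (λ p≡0 → length≡0⇒sum-map≡0 (degree E) {ls} (trans ∣ls∣≡p p≡0))
    , noEdge
    where
    ∣hs∣+p≡m : length hs + p ≡ m
    ∣hs∣+p≡m = begin
      length hs + p         ≡⟨ cong (length hs +_) ∣ls∣≡p ⟨
      length hs + length ls ≡⟨ +-comm (length hs) (length ls) ⟩
      length ls + length hs ≡⟨ length-++ ls ⟨
      length (ls ++ hs)     ≡⟨ ↭-length ls++hs↭ ⟩
      length (allFin m)     ≡⟨ length-allFin m ⟩
      m                     ∎
      where open ≡-Reasoning
    p≤∣X′∣ : p ≤ ∣ avoiding hs ∣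
    p≤∣X′∣ = +-cancelˡ-≤ (length hs) p ∣ avoiding hs ∣
      (subst (_≤ length hs + ∣ avoiding hs ∣) (sym ∣hs∣+p≡m) (m≤length+∣avoiding∣ hs))
    noEdge : ∀ x y → x ∈ avoiding hs → y ∈ commonNonNeighbours E ls → E x y ≡ false
    noEdge x y x∈X′ y∈Y′ with ∈-++⁻ ls (∈-resp-↭ (↭-sym ls++hs↭) (∈-allFin x))
    ... | inj₁ x∈ls = commonNonNeighbours-noEdge E x∈ls y∈Y′
    ... | inj₂ x∈hs = contradiction x∈hs (avoiding-∉ x∈X′)

  m<[1+m/n]*n : ∀ m n .{{_ : ℕ.NonZero n}} → m < suc (m ℕ./ n) * n
  m<[1+m/n]*n m n = begin-strict
    m                       ≡⟨ ℕ.m≡m%n+[m/n]*n m n ⟩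
    m ℕ.% n + m ℕ./ n * n   <⟨ +-monoˡ-< (m ℕ./ n * n) (ℕ.m%n<n m n) ⟩
    n + m ℕ./ n * n         ∎
    where open ≤-Reasoning

  -- m * s ≤ p * e is vacuous when m = 0; then p = 0 and s = 0 is used instead.
  s*[1+a+b]≤a*n : ∀ a b {e m n p s} → p ≤ m → e * suc b ≤ a * n → p * suc (a + b) ≤ m * suc b →
    m * s ≤ p * e → (p ≡ 0 → s ≡ 0) → s * suc (a + b) ≤ a * n
  s*[1+a+b]≤a*n a b {p = zero} _ _ _ _ s≡0 rewrite s≡0 refl = z≤n
  s*[1+a+b]≤a*n a b {e} {m} {n} {suc p} {s} (s≤s _) ed≤an pc≤md ms≤pe _ =
    *-cancelˡ-≤ (m * suc b) (begin
      (m * suc b) * (s * c)     ≡⟨ solve 4 (λ M B S C → (M :* B) :* (S :* C) := (M :* S) :* (C :* B))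
                                           refl m (suc b) s c ⟩
      (m * s) * (c * suc b)     ≤⟨ *-monoˡ-≤ (c * suc b) ms≤pe ⟩
      (suc p * e) * (c * suc b) ≡⟨ solve 4 (λ P E C B → (P :* E) :* (C :* B) := (P :* C) :* (E :* B))
                                           refl (suc p) e c (suc b) ⟩
      (suc p * c) * (e * suc b) ≤⟨ *-mono-≤ pc≤md ed≤an ⟩
      (m * suc b) * (a * n)     ∎)
    where
    open ≤-Reasoning
    c = suc (a + b)

  s+q≤n : ∀ a b {e m n p q s} → p ≤ m → e * suc b ≤ a * n → p * suc (a + b) ≤ m * suc b →
    q * suc (a + b) ≤ n * suc b → m * s ≤ p * e → (p ≡ 0 → s ≡ 0) → s + q ≤ n
  s+q≤n a b {e} {m} {n} {p} {q} {s} p≤m ed≤an pc≤md qc≤nd ms≤pe p≡0⇒s≡0 = *-cancelʳ-≤ (s + q) n c (begin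
    (s + q) * c       ≡⟨ *-distribʳ-+ c s q ⟩
    s * c + q * c     ≤⟨ +-mono-≤ (s*[1+a+b]≤a*n a b p≤m ed≤an pc≤md ms≤pe p≡0⇒s≡0) qc≤nd ⟩
    a * n + n * suc b ≡⟨ solve 3 (λ A B N → A :* N :+ N :* (con 1 :+ B) := N :* (con 1 :+ (A :+ B))) refl a b n ⟩
    n * c             ∎)
    where
    open ≤-Reasoning
    c = suc (a + b)

open Counting

open import Data.Nat.Coprimality using (Coprime; 1-coprimeTo) renaming (sym to coprime-sym)
open import Data.Integer as ℤ using (+_; +≤+; +<+) renaming (_≤_ to _≤ℤ_)
import Data.Integer.DivMod as ℤ
import Data.Integer.Properties as ℤ
open import Data.Rational
  using (ℚ; mkℚ; 0ℚ; 1ℚ; _<_; _≤_; _*_; _+_; _÷_; 1/_; floor; toℚᵘ; *<*;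
         Positive; NonNegative; NonZero; positive)
open import Data.Rational.Properties
  using (normalize-coprime; toℚᵘ-mono-≤; toℚᵘ-cancel-<; toℚᵘ-homo-*; toℚᵘ-homo-+; drop-*<*;
         *-cancelʳ-<-nonNeg; pos+nonNeg⇒pos; pos⇒nonZero; pos⇒nonNeg; *-assoc; *-inverseˡ; *-identityʳ)
import Data.Rational.Unnormalised as ℚᵘ
import Data.Rational.Unnormalised.Properties as ℚᵘ

coprime-1 : ∀ k → Coprime k 1
coprime-1 k = coprime-sym (1-coprimeTo k)

toℚ≡mkℚ : ∀ k → toℚ k ≡ mkℚ (+ k) 0 (coprime-1 k)
toℚ≡mkℚ k = normalize-coprime (coprime-1 k)

+*+≡+ : ∀ x y → + x ℤ.* + y ≡ + (x ℕ.* y)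
+*+≡+ x y = sym (ℤ.pos-* x y)

floor<⇒≤ : ∀ x p → x < toℚ (suc p) → floor x ≤ℤ + p
floor<⇒≤ x@(mkℚ n d _) p x<p+1 = ℤ.i<j⇒i≤pred[j]
  (ℤ.*-cancelʳ-<-nonNeg {j = + suc p} (+ suc d) (ℤ.≤-<-trans (ℤ.[n/d]*d≤n n (+ suc d)) n<[p+1]*d))
  where
  n<[p+1]*d : n ℤ.< + suc p ℤ.* + suc d
  n<[p+1]*d = subst (ℤ._< _) (ℤ.*-identityʳ n) (drop-*<* (subst (x <_) (toℚ≡mkℚ (suc p)) x<p+1))

-- r = a/(1+b), so that r + 1 = (1+a+b)/(1+b).
module _ {a b} .{cop : Coprime a (suc b)} where

  private
    r = mkℚ (+ a) b cop

  toℚ≤r*toℚ⇒≤ : ∀ {e n} → toℚ e ≤ r * toℚ n → e ℕ.* suc b ℕ.≤ a ℕ.* n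
  toℚ≤r*toℚ⇒≤ {e} {n} e≤rn rewrite toℚ≡mkℚ e | toℚ≡mkℚ n = ℤ.drop‿+≤+ (subst₂ _≤ℤ_ lhs rhs e*d≤a*n)
    where
    e*d≤a*n : + e ℤ.* + (suc b ℕ.* 1) ≤ℤ (+ a ℤ.* + n) ℤ.* + 1
    e*d≤a*n = ℚᵘ.drop-*≤* (ℚᵘ.≤-respʳ-≃ (toℚᵘ-homo-* r (mkℚ (+ n) 0 (coprime-1 n))) (toℚᵘ-mono-≤ e≤rn))
    lhs : + e ℤ.* + (suc b ℕ.* 1) ≡ + (e ℕ.* suc b)
    lhs = trans (+*+≡+ e (suc b ℕ.* 1)) (cong (λ d → + (e ℕ.* d)) (ℕ.*-identityʳ (suc b)))
    rhs : (+ a ℤ.* + n) ℤ.* + 1 ≡ + (a ℕ.* n)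
    rhs = trans (ℤ.*-identityʳ _) (+*+≡+ a n)

  <⇒toℚ<toℚ*[r+1] : ∀ {k j} → k ℕ.* suc b ℕ.< j ℕ.* suc (a ℕ.+ b) → toℚ k < toℚ j * (r + 1ℚ)
  <⇒toℚ<toℚ*[r+1] {k} {j} kd<jc rewrite toℚ≡mkℚ k | toℚ≡mkℚ j =
    toℚᵘ-cancel-< (ℚᵘ.<-respʳ-≃ (ℚᵘ.≃-sym j*[r+1]≃) (ℚᵘ.*<* (subst₂ ℤ._<_ (sym lhs) (sym rhs) (+<+ kd<jc))))
    where
    jℚ = mkℚ (+ j) 0 (coprime-1 j)
    j*[r+1]≃ : toℚᵘ (jℚ * (r + 1ℚ)) ℚᵘ.≃ toℚᵘ jℚ ℚᵘ.* (toℚᵘ r ℚᵘ.+ toℚᵘ 1ℚ)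
    j*[r+1]≃ = ℚᵘ.≃-trans (toℚᵘ-homo-* jℚ (r + 1ℚ)) (ℚᵘ.*-congˡ {toℚᵘ jℚ} (toℚᵘ-homo-+ r 1ℚ))
    lhs : + k ℤ.* + (1 ℕ.* (suc b ℕ.* 1)) ≡ + (k ℕ.* suc b)
    lhs = trans (+*+≡+ k _) (cong (λ d → + (k ℕ.* d)) (trans (ℕ.*-identityˡ _) (ℕ.*-identityʳ (suc b))))
    rhs : (+ j ℤ.* (+ a ℤ.* + 1 ℤ.+ + 1 ℤ.* + suc b)) ℤ.* + 1 ≡ + (j ℕ.* suc (a ℕ.+ b))
    rhs = begin
      (+ j ℤ.* (+ a ℤ.* + 1 ℤ.+ + 1 ℤ.* + suc b)) ℤ.* + 1 ≡⟨ ℤ.*-identityʳ _ ⟩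
      + j ℤ.* (+ a ℤ.* + 1 ℤ.+ + 1 ℤ.* + suc b)
        ≡⟨ cong (+ j ℤ.*_) (cong₂ ℤ._+_ (ℤ.*-identityʳ (+ a)) (ℤ.*-identityˡ (+ suc b))) ⟩
      + j ℤ.* (+ a ℤ.+ + suc b)                         ≡⟨ cong (+ j ℤ.*_) (ℤ.pos-+ a (suc b)) ⟨
      + j ℤ.* + (a ℕ.+ suc b)                           ≡⟨ +*+≡+ j (a ℕ.+ suc b) ⟩
      + (j ℕ.* (a ℕ.+ suc b))                           ≡⟨ cong (λ c → + (j ℕ.* c)) (ℕ.+-suc a b) ⟩
      + (j ℕ.* suc (a ℕ.+ b))                           ∎
      where open ≡-Reasoning

  floorDivSucc≤ : ∀ k (0<r : 0ℚ < r) → floorDivSucc k r 0<r ≤ℤ + (k ℕ.* suc b ℕ./ suc (a ℕ.+ b))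
  floorDivSucc≤ k 0<r = floor<⇒≤ (toℚ k ÷ (r + 1ℚ)) p
    (*-cancelʳ-<-nonNeg (r + 1ℚ) (subst (_< toℚ (suc p) * (r + 1ℚ)) (sym k÷s*s≡k)
      (<⇒toℚ<toℚ*[r+1] {k} {suc p} (m<[1+m/n]*n (k ℕ.* suc b) (suc (a ℕ.+ b))))))
    where
    p = k ℕ.* suc b ℕ./ suc (a ℕ.+ b)
    instance
      r+1-pos : Positive (r + 1ℚ)
      r+1-pos = pos+nonNeg⇒pos r {{positive 0<r}} 1ℚ
      r+1-nonZero : NonZero (r + 1ℚ)
      r+1-nonZero = pos⇒nonZero (r + 1ℚ)
      r+1-nonNeg : NonNegative (r + 1ℚ)
      r+1-nonNeg = pos⇒nonNeg (r + 1ℚ)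
    k÷s*s≡k : (toℚ k ÷ (r + 1ℚ)) * (r + 1ℚ) ≡ toℚ k
    k÷s*s≡k = begin
      (toℚ k * 1/ (r + 1ℚ)) * (r + 1ℚ) ≡⟨ *-assoc (toℚ k) _ _ ⟩
      toℚ k * (1/ (r + 1ℚ) * (r + 1ℚ)) ≡⟨ cong (toℚ k *_) (*-inverseˡ (r + 1ℚ)) ⟩
      toℚ k * 1ℚ                       ≡⟨ *-identityʳ (toℚ k) ⟩
      toℚ k                            ∎
      where open ≡-Reasoning

lemma2p1 : ∀ {m n} (r : ℚ) (0<r : 0ℚ < r) (E : BipGraph m n) →
    toℚ (edgeCount E) ≤ r * toℚ n →
    Σ (Subset m) λ X′ → Σ (Subset n) λ Y′ →
      (floorDivSucc m r 0<r ≤ℤ + ∣ X′ ∣) ×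
      (floorDivSucc n r 0<r ≤ℤ + ∣ Y′ ∣) ×
      (∀ x y → x ∈ X′ → y ∈ Y′ → E x y ≡ false)
lemma2p1 (mkℚ ℤ.-[1+ _ ] _ _) (*<* ()) _ _
lemma2p1 {m} {n} (mkℚ (+ a) b _) 0<r E e≤rn =
  let X′ , Y′ , s , p≤∣X′∣ , n≤s+∣Y′∣ , ms≤pe , p≡0⇒s≡0 , noEdge = edgeless-pair E p≤m
      s+q≤n′ = s+q≤n a b p≤m (toℚ≤r*toℚ⇒≤ {e = edgeCount E} {n = n} e≤rn) pc≤md qc≤nd ms≤pe p≡0⇒s≡0
      q≤∣Y′∣ = ℕ.+-cancelˡ-≤ s q ∣ Y′ ∣ (ℕ.≤-trans s+q≤n′ n≤s+∣Y′∣)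
  in X′ , Y′
   , ℤ.≤-trans (floorDivSucc≤ m 0<r) (+≤+ p≤∣X′∣)
   , ℤ.≤-trans (floorDivSucc≤ n 0<r) (+≤+ q≤∣Y′∣)
   , noEdge
  where
  c = suc (a ℕ.+ b)
  p = m ℕ.* suc b ℕ./ c
  q = n ℕ.* suc b ℕ./ c
  pc≤md : p ℕ.* c ℕ.≤ m ℕ.* suc b
  pc≤md = ℕ.m/n*n≤m (m ℕ.* suc b) c
  qc≤nd : q ℕ.* c ℕ.≤ n ℕ.* suc b
  qc≤nd = ℕ.m/n*n≤m (n ℕ.* suc b) c
  p≤m : p ℕ.≤ m
  p≤m = ℕ.*-cancelʳ-≤ p m c (ℕ.≤-trans pc≤md (ℕ.*-monoʳ-≤ m (ℕ.s≤s (ℕ.m≤n+m b a))))
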